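{- Let $G_1$ and $G_2$ be vertex-disjoint graphs, $u \in V(G_1)$, $v \in V(G_2)$. Let $G$ be the graph obtained from $G_1 \cup G_2$ by adding the edge $uv$, and let $G'$ be the graph obtained from $G_1\cup G_2$ by identifying $u$ with $v$ and attaching a new pendant vertex to the common vertex. If $d_G(u) \ge 2$ and $d_G(v) \ge 2$, then $HM(G) < HM(G')$.
   Context: Graphs are simple, finite and undirected; $d_G(x)$ denotes the degree of $x$ in $G$. $HM(G)=\sum_{xy\in E(G)}(d_G(x)+d_G(y))^2$. -}

module Defs where

open import Data.Nat using (ℕ; zero; suc; _+_; _*_; _<ᵇ_)
open import Data.Fin using (Fin; zero; suc; toℕ; _↑ˡ_; _↑ʳ_; splitAt; punchIn; punchOut)
open import Data.Fin.Properties using (_≟_; suc-injective)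
open import Data.Bool using (Bool; true; false; _∧_; _∨_; not; if_then_else_)
open import Data.Sum using (inj₁; inj₂)
open import Data.List using (List; []; _∷_; allFin; map; concatMap)
open import Data.Nat.ListAction using (sum)
open import Data.Bool.ListAction using (any)
open import Relation.Nullary.Decidable using (⌊_⌋)
open import Relation.Binary.PropositionalEquality using (_≡_; _≢_; refl; cong)

Adj : ℕ → Set
Adj n = Fin n → Fin n → Bool

record Simple {n : ℕ} (A : Adj n) : Set where
  field
    symm   : ∀ x y → A x y ≡ A y x
    irrefl : ∀ x → A x x ≡ false

_==_ : ∀ {n} → Fin n → Fin n → Bool
x == y = ⌊ x ≟ y ⌋

deg : ∀ {n} → Adj n → Fin n → ℕ
deg A x = sum (map (λ y → if A x y then 1 else 0) (allFin _))

HM : ∀ {n} → Adj n → ℕ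
HM {n} A = sum (concatMap (λ x → map (λ y →
    if (toℕ x <ᵇ toℕ y) ∧ A x y
    then (deg A x + deg A y) * (deg A x + deg A y) else 0) (allFin n)) (allFin n))

union : ∀ {n₁ n₂} → Adj n₁ → Adj n₂ → Adj (n₁ + n₂)
union {n₁} A₁ A₂ x y with splitAt n₁ x | splitAt n₁ y
... | inj₁ a | inj₁ b = A₁ a b
... | inj₂ a | inj₂ b = A₂ a b
... | inj₁ _ | inj₂ _ = false
... | inj₂ _ | inj₁ _ = false

addEdge : ∀ {n} → Adj n → Fin n → Fin n → Adj n
addEdge A a b x y = A x y ∨ ((x == a) ∧ (y == b)) ∨ ((x == b) ∧ (y == a))

-- identify vertex b with vertex a (b ≢ a): vertex b is deleted, and the vertex
-- punchOut b≢a (the image of a) becomes the common vertex, adjacent to all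
-- former neighbours of a and of b (no loops are created).
identify : ∀ {m} → (A : Adj (suc m)) → (a b : Fin (suc m)) → b ≢ a → Adj m
identify {m} A a b b≢a x y =
  not (x == y) ∧
  any (λ p → any (λ q → A p q) (pre y)) (pre x)
  where
    c : Fin m
    c = punchOut b≢a
    pre : Fin m → List (Fin (suc m))
    pre z = punchIn b z ∷ (if z == c then b ∷ [] else [])

pendant : ∀ {m} → Adj m → Fin m → Adj (suc m)
pendant A c zero    zero    = false
pendant A c zero    (suc y) = y == c
pendant A c (suc x) zero    = x == c
pendant A c (suc x) (suc y) = A x y

↑ʳ≢↑ˡ : ∀ {m n} (i : Fin m) (j : Fin n) → m ↑ʳ j ≢ i ↑ˡ n
↑ʳ≢↑ˡ zero    j ()
↑ʳ≢↑ˡ (suc i) j eq = ↑ʳ≢↑ˡ i j (suc-injective eq)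

joinEdge : ∀ {n₁ n₂} → Adj (suc n₁) → Adj (suc n₂) → Fin (suc n₁) → Fin (suc n₂) → Adj (suc n₁ + suc n₂)
joinEdge {n₁} {n₂} A₁ A₂ u v = addEdge (union A₁ A₂) (u ↑ˡ suc n₂) (suc n₁ ↑ʳ v)

joinPendant : ∀ {n₁ n₂} → Adj (suc n₁) → Adj (suc n₂) → Fin (suc n₁) → Fin (suc n₂) → Adj (suc (n₁ + suc n₂))
joinPendant {n₁} {n₂} A₁ A₂ u v =
  pendant (identify (union A₁ A₂) (u ↑ˡ suc n₂) (suc n₁ ↑ʳ v) ne) (punchOut ne)
  where
    ne : suc n₁ ↑ʳ v ≢ u ↑ˡ suc n₂
    ne = ↑ʳ≢↑ˡ u v

-- Let K = G₁ ∪ G₂, a = d_K(u) and b = d_K(v). Relabel G′ so that it lives on the vertex set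
-- of G: the common vertex is u, which takes over all K-neighbours of v, and v becomes the
-- pendant vertex at u. Compared with G, the edge uv keeps its weight (a + b + 2)², an edge
-- ux of K goes from weight (a + 1 + d(x))² to (a + b + 1 + d(x))², an edge vy of K turns into
-- the edge uy and goes from (b + 1 + d(y))² to (a + b + 1 + d(y))², and every other edge, with
-- both end degrees, is untouched. Since the neighbourhoods of u and v in K are disjoint, no
-- two edges merge, so HM can only grow; it grows strictly because u has a neighbour (a ≥ 1)
-- and b ≥ 1.
module Submission where

open import Defs
open import Algebra.Bundles using (CommutativeMonoid)
open import Data.Bool using (Bool; true; false; _∧_; _∨_; not; if_then_else_; T)
open import Data.Bool.ListAction using (any; or)
open import Data.Bool.Properties using (∨-identityʳ; ∨-comm; ∧-comm; ∧-zeroʳ; ∨-commutativeMonoid)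
open import Data.Empty using (⊥-elim)
open import Data.Fin using (Fin; zero; suc; toℕ; punchIn; punchOut; splitAt; _↑ˡ_; _↑ʳ_)
open import Data.Fin.Permutation using (Permutation′; insert; id; _⟨$⟩ʳ_)
open import Data.Fin.Properties
  using (_≟_; toℕ-injective; punchIn-injective; punchInᵢ≢i; punchIn-punchOut; splitAt-↑ˡ; splitAt-↑ʳ)
open import Data.List using (List; []; _∷_; map; tabulate; concatMap; allFin)
open import Data.List.Properties using (map-cong)
import Data.Nat.ListAction as List
open import Data.Nat.ListAction.Properties using (sum-++)
open import Data.Nat using (ℕ; zero; suc; _+_; _*_; _≤_; _<_; _<ᵇ_; z≤n)
open import Data.Nat.Properties
  using ( ≤-reflexive; ≤-trans; ≤-antisym; <-asym; ≮⇒≥; <ᵇ⇒<; +-identityʳ; +-comm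
        ; +-mono-≤; +-mono-<-≤; +-mono-≤-<; +-monoˡ-≤; +-monoʳ-≤; +-monoˡ-<; +-cancelʳ-≤; *-mono-≤; *-mono-<
        ; *-cancelʳ-<; *-suc; *-identityʳ; m≤m+n; m≤n+m; m<m+n; <⇒<ᵇ; +-0-commutativeMonoid; module ≤-Reasoning)
open import Data.Nat.Tactic.RingSolver using (solve-∀)
open import Data.Product using (_×_; _,_; proj₁; proj₂; ∃-syntax)
open import Data.Sum using (inj₁; inj₂)
open import Data.Unit using (tt)
open import Function using (_∘_)
open import Relation.Binary.PropositionalEquality
  using (_≡_; _≢_; refl; sym; trans; cong; cong₂; subst; module ≡-Reasoning)
open import Relation.Nullary using (yes; no; ¬_)
open import Relation.Nullary.Decidable using (isYes≗does; dec-true; dec-false; toSum)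
open import Algebra.Properties.CommutativeMonoid.Sum +-0-commutativeMonoid
  using (sum; sum-syntax; sum-remove; sum-cong-≗; sum-replicate-zero; sum-permute; ∑-distrib-+; ∑-comm)
open import Algebra.Properties.CommutativeSemigroup (CommutativeMonoid.commutativeSemigroup ∨-commutativeMonoid)
  using (interchange)

true≢false : true ≢ false
true≢false ()

==-refl : ∀ {n} (x : Fin n) → (x == x) ≡ true
==-refl x = trans (isYes≗does (x ≟ x)) (dec-true (x ≟ x) refl)

==-≢ : ∀ {n} {x y : Fin n} → x ≢ y → (x == y) ≡ false
==-≢ {x = x} {y} x≢y = trans (isYes≗does (x ≟ y)) (dec-false (x ≟ y) x≢y)

==-sym : ∀ {n} (x y : Fin n) → (x == y) ≡ (y == x)
==-sym x y with x ≟ y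
... | yes refl = sym (==-refl x)
... | no x≢y = sym (==-≢ (x≢y ∘ sym))

==-∧-false : ∀ {n} {x y a b : Fin n} → ¬ (x ≡ a × y ≡ b) → ((x == a) ∧ (y == b)) ≡ false
==-∧-false {x = x} {y} {a} {b} ¬xy≡ab with x ≟ a | y ≟ b
... | yes refl | yes refl = ⊥-elim (¬xy≡ab (refl , refl))
... | yes _    | no _     = refl
... | no _     | _        = refl

∑-zero : ∀ {n} {f : Fin n → ℕ} → (∀ i → f i ≡ 0) → sum f ≡ 0
∑-zero {n} f≡0 = trans (sum-cong-≗ f≡0) (sum-replicate-zero n)

∑-mono-≤ : ∀ {n} {f g : Fin n → ℕ} → (∀ i → f i ≤ g i) → sum f ≤ sum g
∑-mono-≤ {zero}  f≤g = z≤n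
∑-mono-≤ {suc n} f≤g = +-mono-≤ (f≤g zero) (∑-mono-≤ (f≤g ∘ suc))

∑-mono-< : ∀ {n} {f g : Fin (suc n) → ℕ} → (∀ i → f i ≤ g i) → ∀ j → f j < g j → sum f < sum g
∑-mono-< {f = f} {g} f≤g j fj<gj rewrite sum-remove {i = j} f | sum-remove {i = j} g =
  +-mono-<-≤ fj<gj (∑-mono-≤ (f≤g ∘ punchIn j))

∑-point : ∀ {n} (j : Fin n) (c : ℕ) → ∑[ i < n ] (if i == j then c else 0) ≡ c
∑-point {suc _} j c = begin
  ∑[ i < _ ] δ i                      ≡⟨ sum-remove {i = j} δ ⟩
  δ j + ∑[ i < _ ] δ (punchIn j i)    ≡⟨ cong₂ _+_ (cong (λ b → if b then c else 0) (==-refl j))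
                                                   (∑-zero (cong (λ b → if b then c else 0) ∘ ==-≢ ∘ punchInᵢ≢i j)) ⟩
  c + 0                               ≡⟨ +-identityʳ c ⟩
  c                                   ∎
  where
  open ≡-Reasoning
  δ : Fin _ → ℕ
  δ i = if i == j then c else 0

dropPair : ∀ {n} → Fin n → Fin n → (Fin n → ℕ) → Fin n → ℕ
dropPair u v f x = if x == u then 0 else if x == v then 0 else f x

∑-dropPair : ∀ {n} {u v : Fin (suc n)} → v ≢ u → (f : Fin (suc n) → ℕ) →
             sum f ≡ sum (dropPair u v f) + (f u + f v)
∑-dropPair {u = u} {v} v≢u f = begin
  sum f                                              ≡⟨ sum-cong-≗ split ⟩
  ∑[ x < _ ] (dropPair u v f x + (δ u x + δ v x))    ≡⟨ ∑-distrib-+ (dropPair u v f) (λ x → δ u x + δ v x) ⟩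
  sum (dropPair u v f) + ∑[ x < _ ] (δ u x + δ v x)  ≡⟨ cong (sum (dropPair u v f) +_) (∑-distrib-+ (δ u) (δ v)) ⟩
  sum (dropPair u v f) + (sum (δ u) + sum (δ v))     ≡⟨ cong (sum (dropPair u v f) +_) (cong₂ _+_ (∑-point u (f u)) (∑-point v (f v))) ⟩
  sum (dropPair u v f) + (f u + f v)                 ∎
  where
  open ≡-Reasoning
  δ : Fin _ → Fin _ → ℕ
  δ w x = if x == w then f w else 0
  split : ∀ x → f x ≡ dropPair u v f x + (δ u x + δ v x)
  split x with x ≟ u | x ≟ v
  ... | yes refl | yes refl = ⊥-elim (v≢u refl)
  ... | yes refl | no _     = sym (+-identityʳ (f x))
  ... | no _     | yes refl = refl
  ... | no _     | no _     = sym (+-identityʳ (f x))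

module _ {n} {u v : Fin (suc n)} (v≢u : v ≢ u) {f g : Fin (suc n) → ℕ}
         (f≤g-offPair : ∀ x → x ≢ u → x ≢ v → f x ≤ g x) where

  private
    dropPair-≤ : ∀ x → dropPair u v f x ≤ dropPair u v g x
    dropPair-≤ x with x ≟ u | x ≟ v
    ... | yes _   | _       = z≤n
    ... | no _    | yes _   = z≤n
    ... | no x≢u  | no x≢v  = f≤g-offPair x x≢u x≢v

  ∑-mono-≤-offPair : f u + f v ≤ g u + g v → sum f ≤ sum g
  ∑-mono-≤-offPair pair rewrite ∑-dropPair v≢u f | ∑-dropPair v≢u g = +-mono-≤ (∑-mono-≤ dropPair-≤) pair

  ∑-mono-<-offPair : f u + f v < g u + g v → sum f < sum g
  ∑-mono-<-offPair pair rewrite ∑-dropPair v≢u f | ∑-dropPair v≢u g = +-mono-≤-< (∑-mono-≤ dropPair-≤) pair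

∑-cong-offPair : ∀ {n} {u v : Fin (suc n)} → v ≢ u → {f g : Fin (suc n) → ℕ} →
                 (∀ x → x ≢ u → x ≢ v → f x ≡ g x) → f u + f v ≡ g u + g v → sum f ≡ sum g
∑-cong-offPair v≢u f≡g-offPair pair = ≤-antisym
  (∑-mono-≤-offPair v≢u (λ x p q → ≤-reflexive (f≡g-offPair x p q)) (≤-reflexive pair))
  (∑-mono-≤-offPair v≢u (λ x p q → ≤-reflexive (sym (f≡g-offPair x p q))) (≤-reflexive (sym pair)))

sum-map-tabulate : ∀ {A : Set} {n} (g : Fin n → A) (f : A → ℕ) →
                   List.sum (map f (tabulate g)) ≡ ∑[ i < n ] f (g i)
sum-map-tabulate {n = zero}  g f = refl
sum-map-tabulate {n = suc n} g f = cong (f (g zero) +_) (sum-map-tabulate (g ∘ suc) f)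

sum-concatMap : ∀ {A : Set} (F : A → List ℕ) (xs : List A) →
                List.sum (concatMap F xs) ≡ List.sum (map (List.sum ∘ F) xs)
sum-concatMap F []       = refl
sum-concatMap F (x ∷ xs) = trans (sum-++ (F x) (concatMap F xs)) (cong (List.sum (F x) +_) (sum-concatMap F xs))

ind : Bool → ℕ
ind b = if b then 1 else 0

ind-∨ : ∀ β γ → β ∧ γ ≡ false → ind (β ∨ γ) ≡ ind β + ind γ
ind-∨ true  true  ()
ind-∨ true  false _ = refl
ind-∨ false γ     _ = refl

sqIf : Bool → ℕ → ℕ
sqIf b s = if b then s * s else 0

sqIf-merge : ∀ β γ {s t r} → β ∧ γ ≡ false → s ≤ r → t ≤ r → sqIf β s + sqIf γ t ≤ sqIf (β ∨ γ) r
sqIf-merge true  true                  () _ _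
sqIf-merge true  false {s} {t} {r} _ s≤r _ = ≤-trans (≤-reflexive (+-identityʳ (s * s))) (*-mono-≤ s≤r s≤r)
sqIf-merge false true                  _ _ t≤r = *-mono-≤ t≤r t≤r
sqIf-merge false false                 _ _ _   = z≤n

any-cong : ∀ {A : Set} {f g : A → Bool} → (∀ x → f x ≡ g x) → ∀ xs → any f xs ≡ any g xs
any-cong f≗g xs = cong or (map-cong f≗g xs)

any-false : ∀ {A : Set} (xs : List A) → any (λ _ → false) xs ≡ false
any-false []       = refl
any-false (_ ∷ xs) = any-false xs

any-∨ : ∀ {A : Set} (f g : A → Bool) xs → any (λ x → f x ∨ g x) xs ≡ any f xs ∨ any g xs
any-∨ f g []       = refl
any-∨ f g (x ∷ xs) = trans (cong ((f x ∨ g x) ∨_) (any-∨ f g xs)) (interchange (f x) (g x) (any f xs) (any g xs))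

any-comm : ∀ {A B : Set} (R : A → B → Bool) xs ys →
           any (λ x → any (R x) ys) xs ≡ any (λ y → any (λ x → R x y) xs) ys
any-comm R []       ys = sym (any-false ys)
any-comm R (x ∷ xs) ys =
  trans (cong (any (R x) ys ∨_) (any-comm R xs ys)) (sym (any-∨ (R x) (λ y → any (λ x → R x y) xs) ys))

-- Degrees and the hyper-Zagreb index

deg-∑ : ∀ {n} (A : Adj n) x → deg A x ≡ ∑[ y < n ] ind (A x y)
deg-∑ A x = sum-map-tabulate (λ y → y) (ind ∘ A x)

deg-cong : ∀ {n} {A B : Adj n} {x} → (∀ y → A x y ≡ B x y) → deg A x ≡ deg B x
deg-cong {A = A} {B} {x} Axy≡Bxy = trans (deg-∑ A x) (trans (sum-cong-≗ (cong ind ∘ Axy≡Bxy)) (sym (deg-∑ B x)))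

1≤deg⇒neighbour : ∀ {n} (A : Adj n) x → 1 ≤ deg A x → ∃[ y ] A x y ≡ true
1≤deg⇒neighbour {n} A x 1≤d = search n (A x) (subst (1 ≤_) (deg-∑ A x) 1≤d)
  where
  search : ∀ k (f : Fin k → Bool) → 1 ≤ ∑[ y < k ] ind (f y) → ∃[ y ] f y ≡ true
  search zero    f ()
  search (suc k) f 1≤∑ with f zero in fzero
  ... | true  = zero , fzero
  ... | false with search k (f ∘ suc) 1≤∑
  ...   | y , fy = suc y , fy

weight : ∀ {n} → Adj n → Fin n → Fin n → ℕ
weight A x y = sqIf (A x y) (deg A x + deg A y)

weight-≡ : ∀ {n} (A : Adj n) x y {β p q} → A x y ≡ β → deg A x ≡ p → deg A y ≡ q → weight A x y ≡ sqIf β (p + q)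
weight-≡ A x y refl refl refl = refl

weight-diag : ∀ {n} {A : Adj n} → Simple A → ∀ x → weight A x x ≡ 0
weight-diag {A = A} S x = cong (λ β → sqIf β (deg A x + deg A x)) (Simple.irrefl S x)

HMₒ : ∀ {n} → Adj n → ℕ
HMₒ {n} A = ∑[ x < n ] ∑[ y < n ] weight A x y

upperWeight : ∀ {n} → Adj n → Fin n → Fin n → ℕ
upperWeight A x y = sqIf ((toℕ x <ᵇ toℕ y) ∧ A x y) (deg A x + deg A y)

HM-∑ : ∀ {n} (A : Adj n) → HM A ≡ ∑[ x < n ] ∑[ y < n ] upperWeight A x y
HM-∑ {n} A = trans (sum-concatMap row (allFin n))
  (trans (sum-map-tabulate (λ x → x) (List.sum ∘ row)) (sum-cong-≗ λ x → sum-map-tabulate (λ y → y) (upperWeight A x)))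
  where
  row : Fin n → List ℕ
  row x = map (upperWeight A x) (allFin n)

weight-split : ∀ {n} {A : Adj n} → Simple A → ∀ x y → weight A x y ≡ upperWeight A x y + upperWeight A y x
weight-split {A = A} S x y with toℕ x <ᵇ toℕ y in x<y | toℕ y <ᵇ toℕ x in y<x
... | true  | true  = ⊥-elim (<-asym (<ᵇ⇒< (toℕ x) (toℕ y) (subst T (sym x<y) tt)) (<ᵇ⇒< (toℕ y) (toℕ x) (subst T (sym y<x) tt)))
... | true  | false = sym (+-identityʳ _)
... | false | true  = cong₂ sqIf (Simple.symm S x y) (+-comm (deg A x) (deg A y))
... | false | false with toℕ-injective {i = x} {j = y} (≤-antisym (≮⇒≥ (λ y<x′ → subst T y<x (<⇒<ᵇ y<x′)))
                                                                (≮⇒≥ (λ x<y′ → subst T x<y (<⇒<ᵇ x<y′))))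
...   | refl rewrite Simple.irrefl S x = refl

HM-double : ∀ {n} {A : Adj n} → Simple A → HM A * 2 ≡ HMₒ A
HM-double {n} {A} S = begin
  HM A * 2
    ≡⟨ trans (*-suc (HM A) 1) (cong (HM A +_) (*-identityʳ (HM A))) ⟩
  HM A + HM A
    ≡⟨ cong₂ _+_ (HM-∑ A) (trans (HM-∑ A) (∑-comm U)) ⟩
  ∑[ x < n ] ∑[ y < n ] U x y + ∑[ x < n ] ∑[ y < n ] U y x
    ≡⟨ ∑-distrib-+ (λ x → ∑[ y < n ] U x y) (λ x → ∑[ y < n ] U y x) ⟨
  ∑[ x < n ] (∑[ y < n ] U x y + ∑[ y < n ] U y x)
    ≡⟨ sum-cong-≗ (λ x → ∑-distrib-+ (U x) (λ y → U y x)) ⟨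
  ∑[ x < n ] ∑[ y < n ] (U x y + U y x)
    ≡⟨ sum-cong-≗ (λ x → sum-cong-≗ (weight-split S x)) ⟨
  HMₒ A
    ∎
  where
  open ≡-Reasoning
  U = upperWeight A

-- Relabelling vertices

module _ {n} {G H : Adj n} (π : Permutation′ n) (G≅H : ∀ x y → G x y ≡ H (π ⟨$⟩ʳ x) (π ⟨$⟩ʳ y)) where

  private
    ∑-relabel : (f : Fin n → ℕ) → ∑[ x < n ] f (π ⟨$⟩ʳ x) ≡ sum f
    ∑-relabel f = sym (sum-permute f π)

  deg-relabel : ∀ x → deg G x ≡ deg H (π ⟨$⟩ʳ x)
  deg-relabel x = trans (deg-∑ G x) (trans (sum-cong-≗ (cong ind ∘ G≅H x))
                   (trans (∑-relabel (ind ∘ H (π ⟨$⟩ʳ x))) (sym (deg-∑ H (π ⟨$⟩ʳ x)))))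

  HMₒ-relabel : HMₒ G ≡ HMₒ H
  HMₒ-relabel = trans
    (sum-cong-≗ λ x → trans (sum-cong-≗ (λ y → cong₂ sqIf (G≅H x y) (cong₂ _+_ (deg-relabel x) (deg-relabel y))))
                            (∑-relabel (weight H (π ⟨$⟩ʳ x))))
    (∑-relabel (λ x → ∑[ y < n ] weight H x y))

  Simple-relabel : Simple H → Simple G
  Simple-relabel S = record
    { symm   = λ x y → trans (G≅H x y) (trans (Simple.symm S _ _) (sym (G≅H y x)))
    ; irrefl = λ x → trans (G≅H x x) (Simple.irrefl S _)
    }

module _ {n} (A : Adj n) (a b : Fin n) where

  addEdge-≡ : ∀ {x y} → ¬ (x ≡ a × y ≡ b) → ¬ (x ≡ b × y ≡ a) → addEdge A a b x y ≡ A x y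
  addEdge-≡ {x} {y} ¬ab ¬ba rewrite ==-∧-false ¬ab | ==-∧-false ¬ba = ∨-identityʳ (A x y)

  addEdge-edge : addEdge A a b a b ≡ true
  addEdge-edge rewrite ==-refl a | ==-refl b with A a b
  ... | true  = refl
  ... | false = refl

  addEdge-comm : ∀ x y → addEdge A a b x y ≡ addEdge A b a x y
  addEdge-comm x y = cong (A x y ∨_) (∨-comm ((x == a) ∧ (y == b)) _)

  deg-addEdge-other : ∀ {x} → x ≢ a → x ≢ b → deg (addEdge A a b) x ≡ deg A x
  deg-addEdge-other x≢a x≢b = deg-cong {A = addEdge A a b} {A} λ y → addEdge-≡ (x≢a ∘ proj₁) (x≢b ∘ proj₁)

  deg-addEdge-source : a ≢ b → A a b ≡ false → deg (addEdge A a b) a ≡ deg A a + 1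
  deg-addEdge-source a≢b a≁b = begin
    deg (addEdge A a b) a                                ≡⟨ deg-∑ (addEdge A a b) a ⟩
    ∑[ y < n ] ind (addEdge A a b a y)                   ≡⟨ sum-cong-≗ split ⟩
    ∑[ y < n ] (ind (A a y) + (if y == b then 1 else 0)) ≡⟨ ∑-distrib-+ (ind ∘ A a) (λ y → if y == b then 1 else 0) ⟩
    ∑[ y < n ] ind (A a y) + ∑[ y < n ] (if y == b then 1 else 0)
        ≡⟨ cong₂ _+_ (sym (deg-∑ A a)) (∑-point b 1) ⟩
    deg A a + 1                                          ∎
    where
    open ≡-Reasoning
    split : ∀ y → ind (addEdge A a b a y) ≡ ind (A a y) + (if y == b then 1 else 0)
    split y with y ≟ b
    ... | yes refl rewrite ==-refl a | a≁b = refl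
    ... | no _     rewrite ==-refl a | ==-≢ a≢b | ∨-identityʳ (A a y) = sym (+-identityʳ _)

  addEdge-simple : Simple A → a ≢ b → Simple (addEdge A a b)
  addEdge-simple S a≢b = record { symm = symm ; irrefl = irrefl }
    where
    symm : ∀ x y → addEdge A a b x y ≡ addEdge A a b y x
    symm x y = cong₂ _∨_ (Simple.symm S x y)
      (trans (∨-comm ((x == a) ∧ (y == b)) _) (cong₂ _∨_ (∧-comm (x == b) (y == a)) (∧-comm (x == a) (y == b))))
    irrefl : ∀ x → addEdge A a b x x ≡ false
    irrefl x = trans (addEdge-≡ (λ { (refl , refl) → a≢b refl }) (λ { (refl , refl) → a≢b refl })) (Simple.irrefl S x)

deg-addEdge-target : ∀ {n} (A : Adj n) (a b : Fin n) → a ≢ b → A b a ≡ false → deg (addEdge A a b) b ≡ deg A b + 1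
deg-addEdge-target A a b a≢b b≁a =
  trans (deg-cong {A = addEdge A a b} {addEdge A b a} (addEdge-comm A a b b)) (deg-addEdge-source A b a (a≢b ∘ sym) b≁a)

-- Moving the neighbours of v onto u

module MoveNeighbours {m} {K : Adj (suc m)} (K-simple : Simple K) {u v : Fin (suc m)} (v≢u : v ≢ u)
                      (u≁v : K u v ≡ false) (disjoint : ∀ y → K u y ∧ K v y ≡ false) where

  open Simple K-simple

  a b : ℕ
  a = deg K u
  b = deg K v

  u≢v : u ≢ v
  u≢v = v≢u ∘ sym

  v≁u : K v u ≡ false
  v≁u = trans (symm v u) u≁v

  disjoint′ : ∀ x → K x u ∧ K x v ≡ false
  disjoint′ x = trans (cong₂ _∧_ (symm x u) (symm x v)) (disjoint x)

  G : Adj (suc m)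
  G = addEdge K u v

  fibre : Fin (suc m) → List (Fin (suc m))
  fibre x = x ∷ (if x == u then v ∷ [] else [])

  merged : Adj (suc m)
  merged x y = not (x == y) ∧ any (λ p → any (K p) (fibre y)) (fibre x)

  -- The graph G′ transported to the vertex set of G: u is the identified vertex, v the pendant one.
  H : Adj (suc m)
  H x y = if x == v then y == u else if y == v then x == u else merged x y

  any-fibre : ∀ {x} → x ≢ u → (f : Fin (suc m) → Bool) → any f (fibre x) ≡ f x
  any-fibre {x} x≢u f rewrite ==-≢ x≢u = ∨-identityʳ (f x)

  any-fibre-u : (f : Fin (suc m) → Bool) → any f (fibre u) ≡ f u ∨ f v
  any-fibre-u f rewrite ==-refl u = cong (f u ∨_) (∨-identityʳ (f v))

  merged-off : ∀ {x y} → x ≢ u → y ≢ u → merged x y ≡ K x y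
  merged-off {x} {y} x≢u y≢u =
    trans (cong (not (x == y) ∧_) (trans (any-fibre x≢u _) (any-fibre y≢u (K x)))) guard
    where
    guard : not (x == y) ∧ K x y ≡ K x y
    guard with x ≟ y
    ... | yes refl = sym (irrefl x)
    ... | no _     = refl

  merged-from-u : ∀ {y} → y ≢ u → merged u y ≡ K u y ∨ K v y
  merged-from-u y≢u = cong₂ _∧_ (cong not (==-≢ (y≢u ∘ sym)))
    (trans (any-fibre-u _) (cong₂ _∨_ (any-fibre y≢u (K u)) (any-fibre y≢u (K v))))

  merged-to-u : ∀ {x} → x ≢ u → merged x u ≡ K x u ∨ K x v
  merged-to-u x≢u = cong₂ _∧_ (cong not (==-≢ x≢u)) (trans (any-fibre x≢u _) (any-fibre-u _))

  merged-sym : ∀ x y → merged x y ≡ merged y x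
  merged-sym x y = cong₂ _∧_ (cong not (==-sym x y))
    (trans (any-comm K (fibre x) (fibre y)) (any-cong (λ q → any-cong (λ p → symm p q) (fibre x)) (fibre y)))

  merged-irrefl : ∀ x → merged x x ≡ false
  merged-irrefl x rewrite ==-refl x = refl

  H-from-v : ∀ y → H v y ≡ (y == u)
  H-from-v y rewrite ==-refl v = refl

  H-to-v : ∀ {x} → x ≢ v → H x v ≡ (x == u)
  H-to-v x≢v rewrite ==-≢ x≢v | ==-refl v = refl

  H-merged : ∀ {x y} → x ≢ v → y ≢ v → H x y ≡ merged x y
  H-merged x≢v y≢v rewrite ==-≢ x≢v | ==-≢ y≢v = refl

  H-simple : Simple H
  H-simple = record { symm = H-symm ; irrefl = H-irrefl }
    where
    H-symm : ∀ x y → H x y ≡ H y x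
    H-symm x y with toSum (x ≟ v) | toSum (y ≟ v)
    ... | inj₁ refl | inj₁ refl = refl
    ... | inj₁ refl | inj₂ y≢v  = trans (H-from-v y) (sym (H-to-v y≢v))
    ... | inj₂ x≢v  | inj₁ refl = trans (H-to-v x≢v) (sym (H-from-v x))
    ... | inj₂ x≢v  | inj₂ y≢v  = trans (H-merged x≢v y≢v) (trans (merged-sym x y) (sym (H-merged y≢v x≢v)))
    H-irrefl : ∀ x → H x x ≡ false
    H-irrefl x with toSum (x ≟ v)
    ... | inj₁ refl = trans (H-from-v v) (==-≢ v≢u)
    ... | inj₂ x≢v  = trans (H-merged x≢v x≢v) (merged-irrefl x)

  G-off : ∀ {x y} → ¬ (x ≡ u × y ≡ v) → ¬ (x ≡ v × y ≡ u) → G x y ≡ K x y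
  G-off = addEdge-≡ K u v

  G-vu : G v u ≡ true
  G-vu = trans (addEdge-comm K u v v u) (addEdge-edge K v u)

  deg-G-u : deg G u ≡ a + 1
  deg-G-u = deg-addEdge-source K u v u≢v u≁v

  deg-G-v : deg G v ≡ b + 1
  deg-G-v = deg-addEdge-target K u v u≢v v≁u

  deg-G-off : ∀ {x} → x ≢ u → x ≢ v → deg G x ≡ deg K x
  deg-G-off = deg-addEdge-other K u v

  deg-H-v : deg H v ≡ 1
  deg-H-v = trans (deg-∑ H v) (trans (sum-cong-≗ (cong ind ∘ H-from-v)) (∑-point u 1))

  deg-H-u : deg H u ≡ a + b + 1
  deg-H-u = begin
    deg H u                                                       ≡⟨ deg-∑ H u ⟩
    ∑[ y < _ ] ind (H u y)                                        ≡⟨ sum-cong-≗ split ⟩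
    ∑[ y < _ ] (ind (K u y) + ind (K v y) + (if y == v then 1 else 0))
      ≡⟨ ∑-distrib-+ (λ y → ind (K u y) + ind (K v y)) (λ y → if y == v then 1 else 0) ⟩
    ∑[ y < _ ] (ind (K u y) + ind (K v y)) + ∑[ y < _ ] (if y == v then 1 else 0)
      ≡⟨ cong₂ _+_ (∑-distrib-+ (ind ∘ K u) (ind ∘ K v)) (∑-point v 1) ⟩
    ∑[ y < _ ] ind (K u y) + ∑[ y < _ ] ind (K v y) + 1          ≡⟨ cong (_+ 1) (cong₂ _+_ (sym (deg-∑ K u)) (sym (deg-∑ K v))) ⟩
    a + b + 1                                                     ∎
    where
    open ≡-Reasoning
    split : ∀ y → ind (H u y) ≡ ind (K u y) + ind (K v y) + (if y == v then 1 else 0)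
    split y with toSum (y ≟ v) | toSum (y ≟ u)
    ... | inj₁ refl | _         rewrite H-to-v u≢v | ==-refl u | u≁v | irrefl v | ==-refl v = refl
    ... | inj₂ _    | inj₁ refl rewrite Simple.irrefl H-simple u | irrefl u | v≁u | ==-≢ u≢v = refl
    ... | inj₂ y≢v  | inj₂ y≢u  rewrite H-merged u≢v y≢v | merged-from-u y≢u | ==-≢ y≢v =
      trans (ind-∨ (K u y) (K v y) (disjoint y)) (sym (+-identityʳ _))

  deg-H-off : ∀ {x} → x ≢ u → x ≢ v → deg H x ≡ deg K x
  deg-H-off {x} x≢u x≢v = trans (deg-∑ H x) (trans (∑-cong-offPair v≢u same pair) (sym (deg-∑ K x)))
    where
    same : ∀ y → y ≢ u → y ≢ v → ind (H x y) ≡ ind (K x y)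
    same y y≢u y≢v = cong ind (trans (H-merged x≢v y≢v) (merged-off x≢u y≢u))
    pair : ind (H x u) + ind (H x v) ≡ ind (K x u) + ind (K x v)
    pair = begin
      ind (H x u) + ind (H x v)   ≡⟨ cong₂ _+_ (cong ind (trans (H-merged x≢v u≢v) (merged-to-u x≢u)))
                                               (cong ind (trans (H-to-v x≢v) (==-≢ x≢u))) ⟩
      ind (K x u ∨ K x v) + 0     ≡⟨ +-identityʳ _ ⟩
      ind (K x u ∨ K x v)         ≡⟨ ind-∨ (K x u) (K x v) (disjoint′ x) ⟩
      ind (K x u) + ind (K x v)   ∎
      where open ≡-Reasoning

  row : Adj (suc m) → Fin (suc m) → ℕ
  row A x = ∑[ y < suc m ] weight A x y

  a+1≤a+b+1 : a + 1 ≤ a + b + 1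
  a+1≤a+b+1 = +-monoˡ-≤ 1 (m≤m+n a b)

  b+1≤a+b+1 : b + 1 ≤ a + b + 1
  b+1≤a+b+1 = +-monoˡ-≤ 1 (m≤n+m b a)

  weight-off : ∀ {x y} → x ≢ u → x ≢ v → y ≢ u → y ≢ v → weight G x y ≡ weight H x y
  weight-off {x} {y} x≢u x≢v y≢u y≢v =
    trans (weight-≡ G x y (G-off (x≢u ∘ proj₁) (x≢v ∘ proj₁)) (deg-G-off x≢u x≢v) (deg-G-off y≢u y≢v))
          (sym (weight-≡ H x y (trans (H-merged x≢v y≢v) (merged-off x≢u y≢u)) (deg-H-off x≢u x≢v) (deg-H-off y≢u y≢v)))

  row-≤ : ∀ x → x ≢ u → x ≢ v → row G x ≤ row H x
  row-≤ x x≢u x≢v = ∑-mono-≤-offPair v≢u (λ y y≢u y≢v → ≤-reflexive (weight-off x≢u x≢v y≢u y≢v)) pair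
    where
    open ≤-Reasoning
    d = deg K x
    pair : weight G x u + weight G x v ≤ weight H x u + weight H x v
    pair = begin
      weight G x u + weight G x v
        ≡⟨ cong₂ _+_ (weight-≡ G x u (G-off (x≢u ∘ proj₁) (x≢v ∘ proj₁)) (deg-G-off x≢u x≢v) deg-G-u)
                     (weight-≡ G x v (G-off (x≢u ∘ proj₁) (x≢v ∘ proj₁)) (deg-G-off x≢u x≢v) deg-G-v) ⟩
      sqIf (K x u) (d + (a + 1)) + sqIf (K x v) (d + (b + 1))
        ≤⟨ sqIf-merge (K x u) (K x v) (disjoint′ x) (+-monoʳ-≤ d a+1≤a+b+1) (+-monoʳ-≤ d b+1≤a+b+1) ⟩
      sqIf (K x u ∨ K x v) (d + (a + b + 1))
        ≡⟨ sym (+-identityʳ _) ⟩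
      sqIf (K x u ∨ K x v) (d + (a + b + 1)) + 0
        ≡⟨ sym (cong₂ _+_ (weight-≡ H x u (trans (H-merged x≢v u≢v) (merged-to-u x≢u)) (deg-H-off x≢u x≢v) deg-H-u)
                          (cong (λ β → sqIf β (deg H x + deg H v)) (trans (H-to-v x≢v) (==-≢ x≢u)))) ⟩
      weight H x u + weight H x v ∎

  pair-weight : Adj (suc m) → Fin (suc m) → ℕ
  pair-weight A y = weight A u y + weight A v y

  pair-weight-G-off : ∀ {y} → y ≢ u → y ≢ v →
                      pair-weight G y ≡ sqIf (K u y) (a + 1 + deg K y) + sqIf (K v y) (b + 1 + deg K y)
  pair-weight-G-off {y} y≢u y≢v = cong₂ _+_
    (weight-≡ G u y (G-off (y≢v ∘ proj₂) (u≢v ∘ proj₁)) deg-G-u (deg-G-off y≢u y≢v))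
    (weight-≡ G v y (G-off (v≢u ∘ proj₁) (y≢u ∘ proj₂)) deg-G-v (deg-G-off y≢u y≢v))

  pair-weight-H-off : ∀ {y} → y ≢ u → y ≢ v →
                      pair-weight H y ≡ sqIf (K u y ∨ K v y) (a + b + 1 + deg K y) + 0
  pair-weight-H-off {y} y≢u y≢v = cong₂ _+_
    (weight-≡ H u y (trans (H-merged u≢v y≢v) (merged-from-u y≢u)) deg-H-u (deg-H-off y≢u y≢v))
    (cong (λ β → sqIf β (deg H v + deg H y)) (trans (H-from-v y) (==-≢ y≢u)))

  G-simple : Simple G
  G-simple = addEdge-simple K u v K-simple u≢v

  pair-weight-u : pair-weight G u ≡ pair-weight H u
  pair-weight-u = begin
    weight G u u + weight G v u          ≡⟨ cong₂ _+_ (weight-diag G-simple u) (weight-≡ G v u G-vu deg-G-v deg-G-u) ⟩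
    sqIf true (b + 1 + (a + 1))          ≡⟨ cong (λ s → s * s) (arith a b) ⟩
    sqIf true (1 + (a + b + 1))          ≡⟨ sym (cong₂ _+_ (weight-diag H-simple u)
                                                        (weight-≡ H v u (trans (H-from-v u) (==-refl u)) deg-H-v deg-H-u)) ⟩
    weight H u u + weight H v u          ∎
    where
    open ≡-Reasoning
    arith : ∀ a b → b + 1 + (a + 1) ≡ 1 + (a + b + 1)
    arith = solve-∀

  pair-weight-v : pair-weight G v ≡ pair-weight H v
  pair-weight-v = begin
    weight G u v + weight G v v          ≡⟨ cong₂ _+_ (weight-≡ G u v (addEdge-edge K u v) deg-G-u deg-G-v) (weight-diag G-simple v) ⟩
    sqIf true (a + 1 + (b + 1)) + 0      ≡⟨ cong (λ s → s * s + 0) (arith a b) ⟩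
    sqIf true (a + b + 1 + 1) + 0        ≡⟨ sym (cong₂ _+_ (weight-≡ H u v (trans (H-to-v u≢v) (==-refl u)) deg-H-u deg-H-v)
                                                        (weight-diag H-simple v)) ⟩
    weight H u v + weight H v v          ∎
    where
    open ≡-Reasoning
    arith : ∀ a b → a + 1 + (b + 1) ≡ a + b + 1 + 1
    arith = solve-∀

  pair-weight-≤ : ∀ y → pair-weight G y ≤ pair-weight H y
  pair-weight-≤ y with toSum (y ≟ u) | toSum (y ≟ v)
  ... | inj₁ refl | _         = ≤-reflexive pair-weight-u
  ... | inj₂ _    | inj₁ refl = ≤-reflexive pair-weight-v
  ... | inj₂ y≢u  | inj₂ y≢v  = begin
    pair-weight G y                                          ≡⟨ pair-weight-G-off y≢u y≢v ⟩
    sqIf (K u y) (a + 1 + d) + sqIf (K v y) (b + 1 + d)      ≤⟨ sqIf-merge (K u y) (K v y) (disjoint y)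
                                                                  (+-monoˡ-≤ d a+1≤a+b+1) (+-monoˡ-≤ d b+1≤a+b+1) ⟩
    sqIf (K u y ∨ K v y) (a + b + 1 + d)                     ≡⟨ sym (+-identityʳ _) ⟩
    sqIf (K u y ∨ K v y) (a + b + 1 + d) + 0                 ≡⟨ sym (pair-weight-H-off y≢u y≢v) ⟩
    pair-weight H y                                          ∎
    where
    open ≤-Reasoning
    d = deg K y

  pair-weight-< : 1 ≤ b → ∀ y → K u y ≡ true → pair-weight G y < pair-weight H y
  pair-weight-< 1≤b y uy = begin-strict
    pair-weight G y                                          ≡⟨ pair-weight-G-off y≢u y≢v ⟩
    sqIf (K u y) (a + 1 + d) + sqIf (K v y) (b + 1 + d)      ≡⟨ cong₂ (λ β γ → sqIf β (a + 1 + d) + sqIf γ (b + 1 + d)) uy vy ⟩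
    sqIf true (a + 1 + d) + 0                                <⟨ +-monoˡ-< 0 (*-mono-< s<r s<r) ⟩
    sqIf true (a + b + 1 + d) + 0                            ≡⟨ cong (λ β → sqIf (β ∨ K v y) (a + b + 1 + d) + 0) (sym uy) ⟩
    sqIf (K u y ∨ K v y) (a + b + 1 + d) + 0                 ≡⟨ sym (pair-weight-H-off y≢u y≢v) ⟩
    pair-weight H y                                          ∎
    where
    open ≤-Reasoning
    d = deg K y
    y≢u : y ≢ u
    y≢u refl = true≢false (trans (sym uy) (irrefl u))
    y≢v : y ≢ v
    y≢v refl = true≢false (trans (sym uy) u≁v)
    vy : K v y ≡ false
    vy = trans (cong (_∧ K v y) (sym uy)) (disjoint y)
    s<r : a + 1 + d < a + b + 1 + d
    s<r = +-monoˡ-< d (+-monoˡ-< 1 (m<m+n a 1≤b))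

  pair-rows-< : 1 ≤ a → 1 ≤ b → row G u + row G v < row H u + row H v
  pair-rows-< 1≤a 1≤b with 1≤deg⇒neighbour K u 1≤a
  ... | y₀ , uy₀ = begin-strict
    row G u + row G v         ≡⟨ sym (∑-distrib-+ (weight G u) (weight G v)) ⟩
    sum (pair-weight G)       <⟨ ∑-mono-< pair-weight-≤ y₀ (pair-weight-< 1≤b y₀ uy₀) ⟩
    sum (pair-weight H)       ≡⟨ ∑-distrib-+ (weight H u) (weight H v) ⟩
    row H u + row H v         ∎
    where open ≤-Reasoning

  HMₒ-< : 1 ≤ a → 1 ≤ b → HMₒ G < HMₒ H
  HMₒ-< 1≤a 1≤b = ∑-mono-<-offPair v≢u row-≤ (pair-rows-< 1≤a 1≤b)

  c : Fin m
  c = punchOut v≢u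

  G′ : Adj (suc m)
  G′ = pendant (identify K u v v≢u) c

  σ : Permutation′ (suc m)
  σ = insert zero v id

  ==-c : ∀ z → (z == c) ≡ (punchIn v z == u)
  ==-c z with toSum (z ≟ c)
  ... | inj₁ refl = trans (==-refl c) (sym (trans (cong (_== u) (punchIn-punchOut v≢u)) (==-refl u)))
  ... | inj₂ z≢c  = trans (==-≢ z≢c) (sym (==-≢ λ eq → z≢c (punchIn-injective v z c (trans eq (sym (punchIn-punchOut v≢u))))))

  ==-punchIn : ∀ x y → (punchIn v x == punchIn v y) ≡ (x == y)
  ==-punchIn x y with toSum (x ≟ y)
  ... | inj₁ refl = trans (==-refl (punchIn v x)) (sym (==-refl x))
  ... | inj₂ x≢y  = trans (==-≢ (x≢y ∘ punchIn-injective v x y)) (sym (==-≢ x≢y))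

  G′≅H : ∀ x y → G′ x y ≡ H (σ ⟨$⟩ʳ x) (σ ⟨$⟩ʳ y)
  G′≅H zero    zero    = sym (trans (H-from-v v) (==-≢ v≢u))
  G′≅H zero    (suc y) = trans (==-c y) (sym (H-from-v (punchIn v y)))
  G′≅H (suc x) zero    = trans (==-c x) (sym (H-to-v (punchInᵢ≢i v x)))
  G′≅H (suc x) (suc y) rewrite H-merged (punchInᵢ≢i v x) (punchInᵢ≢i v y) | ==-c x | ==-c y | ==-punchIn x y = refl

  HM-G<HM-G′ : 1 ≤ a → 1 ≤ b → HM G < HM G′
  HM-G<HM-G′ 1≤a 1≤b = *-cancelʳ-< 2 (HM G) (HM G′) (begin-strict
    HM G * 2     ≡⟨ HM-double G-simple ⟩
    HMₒ G        <⟨ HMₒ-< 1≤a 1≤b ⟩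
    HMₒ H        ≡⟨ HMₒ-relabel {G = G′} {H} σ G′≅H ⟨
    HMₒ G′       ≡⟨ HM-double (Simple-relabel {G = G′} {H} σ G′≅H H-simple) ⟨
    HM G′ * 2    ∎)
    where open ≤-Reasoning

module _ {n₁ n₂} (A₁ : Adj n₁) (A₂ : Adj n₂) where

  union-simple : Simple A₁ → Simple A₂ → Simple (union A₁ A₂)
  union-simple S₁ S₂ = record { symm = symm ; irrefl = irrefl }
    where
    symm : ∀ x y → union A₁ A₂ x y ≡ union A₁ A₂ y x
    symm x y with splitAt n₁ x | splitAt n₁ y
    ... | inj₁ i | inj₁ j = Simple.symm S₁ i j
    ... | inj₁ _ | inj₂ _ = refl
    ... | inj₂ _ | inj₁ _ = refl
    ... | inj₂ i | inj₂ j = Simple.symm S₂ i j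
    irrefl : ∀ x → union A₁ A₂ x x ≡ false
    irrefl x with splitAt n₁ x
    ... | inj₁ i = Simple.irrefl S₁ i
    ... | inj₂ i = Simple.irrefl S₂ i

  union-↑ˡ-↑ʳ : ∀ i j → union A₁ A₂ (i ↑ˡ n₂) (n₁ ↑ʳ j) ≡ false
  union-↑ˡ-↑ʳ i j rewrite splitAt-↑ˡ n₁ i n₂ | splitAt-↑ʳ n₁ n₂ j = refl

  union-no-common-neighbour : ∀ i j y → union A₁ A₂ (i ↑ˡ n₂) y ∧ union A₁ A₂ (n₁ ↑ʳ j) y ≡ false
  union-no-common-neighbour i j y rewrite splitAt-↑ˡ n₁ i n₂ | splitAt-↑ʳ n₁ n₂ j with splitAt n₁ y
  ... | inj₁ k = ∧-zeroʳ (A₁ i k)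
  ... | inj₂ _ = refl

lemma2p2 : ∀ {n₁ n₂ : ℕ} (A₁ : Adj (suc n₁)) (A₂ : Adj (suc n₂)) → Simple A₁ → Simple A₂ →
    (u : Fin (suc n₁)) (v : Fin (suc n₂)) →
    2 ≤ deg (joinEdge A₁ A₂ u v) (u ↑ˡ suc n₂) →
    2 ≤ deg (joinEdge A₁ A₂ u v) (suc n₁ ↑ʳ v) →
    HM (joinEdge A₁ A₂ u v) < HM (joinPendant A₁ A₂ u v)
lemma2p2 A₁ A₂ S₁ S₂ u v 2≤dᵤ 2≤dᵥ =
  HM-G<HM-G′ (+-cancelʳ-≤ 1 1 a (subst (2 ≤_) deg-G-u 2≤dᵤ)) (+-cancelʳ-≤ 1 1 b (subst (2 ≤_) deg-G-v 2≤dᵥ))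
  where
  open MoveNeighbours (union-simple A₁ A₂ S₁ S₂) (↑ʳ≢↑ˡ u v) (union-↑ˡ-↑ʳ A₁ A₂ u v) (union-no-common-neighbour A₁ A₂ u v)
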